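{- Let $G$ be a finite, simple, connected graph with $res(G)=3$. Then $\Delta(G)\leq 5$.
   Context: $d$ denotes graph distance and $\Delta(G)$ the maximum degree. For an ordered set $W=\{w_1,\dots,w_k\}\subseteq V(G)$ and $v\in V(G)$, $r(v|W)=(d(v,w_1),\dots,d(v,w_k))$. $W$ is a resolving set if distinct vertices of $G$ have distinct representations with respect to $W$. The resolving number $res(G)$ is the minimum $k$ such that every $k$-subset of $V(G)$ is a resolving set of $G$. -}

module Defs where

open import Data.Nat using (ℕ; zero; suc; _≤_; _<_)
open import Data.Bool using (Bool; true; false)
open import Data.Fin using (Fin)
open import Data.Fin.Subset using (Subset; _∈_; ∣_∣)
open import Data.Vec using (tabulate)
open import Data.Product using (Σ; ∃; _×_)
open import Relation.Nullary using (¬_)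
open import Relation.Binary.PropositionalEquality using (_≡_)

record Graph (n : ℕ) : Set where
  field
    adj    : Fin n → Fin n → Bool
    sym    : ∀ u v → adj u v ≡ adj v u
    irrefl : ∀ v → adj v v ≡ false

module _ {n : ℕ} (G : Graph n) where
  open Graph G

  data Walk : Fin n → Fin n → ℕ → Set where
    nil  : ∀ {u} → Walk u u zero
    cons : ∀ {u w v k} → adj u w ≡ true → Walk w v k → Walk u v (suc k)

  Connected : Set
  Connected = ∀ u v → ∃ λ k → Walk u v k

  Dist : Fin n → Fin n → ℕ → Set
  Dist u v k = Walk u v k × (∀ m → Walk u v m → k ≤ m)

  Resolving : Subset n → Set
  Resolving W = ∀ u v →
    (∀ w → w ∈ W → ∀ k → Dist u w k → Dist v w k) → u ≡ v

  AllResolving : ℕ → Set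
  AllResolving k = ∀ (W : Subset n) → ∣ W ∣ ≡ k → Resolving W

  ResNumber : ℕ → Set
  ResNumber k = AllResolving k × (∀ j → j < k → ¬ AllResolving j)

  neighbours : Fin n → Subset n
  neighbours v = tabulate (adj v)

  degree : Fin n → ℕ
  degree v = ∣ neighbours v ∣

  MaxDegree≤ : ℕ → Set
  MaxDegree≤ d = ∀ v → degree v ≤ d

module Submission where

-- Only the fact that every 3-subset of V(G) is resolving is used.  Suppose a
-- vertex v had six distinct neighbours a, x₁, …, x₅.  Colouring each xᵢ by
-- whether it is adjacent to a, the pigeonhole principle yields three of them,
-- c₁ c₂ c₃, that a sees alike.  Among the three adjacency bits of the pairs of
-- {c₁, c₂, c₃} two coincide, so some cᵢ = b sees the other two, c and d,
-- alike.  Now c and d are equidistant from v (both adjacent to it), from a and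
-- from b: all of v, a, b, c, d are within distance two of one another
-- through v, so each distance is 1 or 2 according to adjacency alone.  Hence
-- the 3-set {v, a, b} does not resolve c and d, a contradiction.

open import Defs
open import Data.Nat using (ℕ; zero; suc; _+_; _∸_; _≤_; z≤n; s≤s; s≤s⁻¹; _≤?_)
open import Data.Nat.Properties using (≤-antisym; ≰⇒>; m+n∸m≡n; ∸-monoʳ-≤; module ≤-Reasoning)
open import Data.Bool using (Bool; true; false)
open import Data.Bool.Properties using (¬-not)
open import Data.Fin using (Fin; zero; suc; inject≤)
open import Data.Fin.Patterns using (0F; 1F; 2F)
open import Data.Fin.Properties using (suc-injective; inject≤-injective)
open import Data.Fin.Subset using (Subset; _∈_; _∉_; ∣_∣; ⁅_⁆; _∪_; ∁; inside; outside)
open import Data.Fin.Subset.Properties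
  using (x∈⁅y⁆⇒x≡y; x≢y⇒x∉⁅y⁆; ∣⁅x⁆∣≡1; x∈p∪q⁻; ∪-identityˡ; ∣∁p∣≡n∸∣p∣; x∈∁p⇒x∉p)
open import Data.Vec using ([]; _∷_; tabulate; here; there)
open import Data.Vec.Properties using ([]=⇒lookup; lookup⇒[]=; lookup∘tabulate)
open import Data.Product using (Σ; ∃; _×_; _,_)
open import Data.Sum using (_⊎_; inj₁; inj₂)
open import Data.Empty using (⊥; ⊥-elim)
open import Function using (_∘_)
open import Function.Definitions using (Injective)
open import Relation.Nullary using (¬_; yes; no; contradiction)
open import Relation.Binary.PropositionalEquality
  using (_≡_; _≢_; refl; sym; trans; cong; subst)

Selection : ∀ {n} → ℕ → Subset n → Set
Selection {n} k p = Σ (Fin k → Fin n) λ f → Injective _≡_ _≡_ f × (∀ i → f i ∈ p)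

enumerate : ∀ {n} (p : Subset n) → Selection ∣ p ∣ p
enumerate [] = (λ ()) , (λ { {()} }) , (λ ())
enumerate (outside ∷ p) with enumerate p
... | f , f-inj , f∈p = suc ∘ f , f-inj ∘ suc-injective , there ∘ f∈p
enumerate (inside ∷ p) with enumerate p
... | f , f-inj , f∈p = g , g-inj , g∈p
  where
  g : Fin (suc ∣ p ∣) → Fin _
  g zero    = zero
  g (suc i) = suc (f i)
  g-inj : Injective _≡_ _≡_ g
  g-inj {zero}  {zero}  _  = refl
  g-inj {suc i} {suc j} eq = cong suc (f-inj (suc-injective eq))
  g∈p : ∀ i → g i ∈ inside ∷ p
  g∈p zero    = here
  g∈p (suc i) = there (f∈p i)

choose : ∀ {n} k (p : Subset n) → k ≤ ∣ p ∣ → Selection k p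
choose k p k≤∣p∣ with enumerate p
... | f , f-inj , f∈p =
  f ∘ embed , (λ eq → inject≤-injective k≤∣p∣ k≤∣p∣ _ _ (f-inj eq)) , f∈p ∘ embed
  where
  embed : Fin k → Fin ∣ p ∣
  embed i = inject≤ i k≤∣p∣

∈-tabulate⁻ : ∀ {n} (g : Fin n → Bool) {x} → x ∈ tabulate g → g x ≡ true
∈-tabulate⁻ g {x} x∈ = trans (sym (lookup∘tabulate g x)) ([]=⇒lookup x∈)

∈-tabulate⁺ : ∀ {n} (g : Fin n → Bool) {x} → g x ≡ true → x ∈ tabulate g
∈-tabulate⁺ g {x} gx = lookup⇒[]= x (tabulate g) (trans (lookup∘tabulate g x) gx)

∣⁅x⁆∪p∣≡1+∣p∣ : ∀ {n} (x : Fin n) (p : Subset n) → x ∉ p → ∣ ⁅ x ⁆ ∪ p ∣ ≡ suc ∣ p ∣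
∣⁅x⁆∪p∣≡1+∣p∣ zero    (inside  ∷ p) x∉p = contradiction here x∉p
∣⁅x⁆∪p∣≡1+∣p∣ zero    (outside ∷ p) x∉p = cong (suc ∘ ∣_∣) (∪-identityˡ p)
∣⁅x⁆∪p∣≡1+∣p∣ (suc x) (inside  ∷ p) x∉p = cong suc (∣⁅x⁆∪p∣≡1+∣p∣ x p (x∉p ∘ there))
∣⁅x⁆∪p∣≡1+∣p∣ (suc x) (outside ∷ p) x∉p = ∣⁅x⁆∪p∣≡1+∣p∣ x p (x∉p ∘ there)

triple : ∀ {n} → Fin n → Fin n → Fin n → Subset n
triple x y z = ⁅ x ⁆ ∪ ⁅ y ⁆ ∪ ⁅ z ⁆

∈-triple⁻ : ∀ {n} {w x y z : Fin n} → w ∈ triple x y z → w ≡ x ⊎ w ≡ y ⊎ w ≡ z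
∈-triple⁻ {x = x} {y} {z} w∈ with x∈p∪q⁻ ⁅ x ⁆ (⁅ y ⁆ ∪ ⁅ z ⁆) w∈
... | inj₁ w∈x = inj₁ (x∈⁅y⁆⇒x≡y x w∈x)
... | inj₂ w∈yz with x∈p∪q⁻ ⁅ y ⁆ ⁅ z ⁆ w∈yz
...   | inj₁ w∈y = inj₂ (inj₁ (x∈⁅y⁆⇒x≡y y w∈y))
...   | inj₂ w∈z = inj₂ (inj₂ (x∈⁅y⁆⇒x≡y z w∈z))

∣triple∣≡3 : ∀ {n} {x y z : Fin n} → x ≢ y → x ≢ z → y ≢ z → ∣ triple x y z ∣ ≡ 3
∣triple∣≡3 {x = x} {y} {z} x≢y x≢z y≢z = begin
  ∣ ⁅ x ⁆ ∪ ⁅ y ⁆ ∪ ⁅ z ⁆ ∣ ≡⟨ ∣⁅x⁆∪p∣≡1+∣p∣ x _ x∉yz ⟩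
  suc ∣ ⁅ y ⁆ ∪ ⁅ z ⁆ ∣     ≡⟨ cong suc (∣⁅x⁆∪p∣≡1+∣p∣ y _ (x≢y⇒x∉⁅y⁆ y≢z)) ⟩
  suc (suc ∣ ⁅ z ⁆ ∣)       ≡⟨ cong (λ k → suc (suc k)) (∣⁅x⁆∣≡1 z) ⟩
  3                         ∎
  where
  open Relation.Binary.PropositionalEquality.≡-Reasoning
  x∉yz : x ∉ ⁅ y ⁆ ∪ ⁅ z ⁆
  x∉yz x∈ with x∈p∪q⁻ ⁅ y ⁆ ⁅ z ⁆ x∈
  ... | inj₁ x∈y = x≢y (x∈⁅y⁆⇒x≡y y x∈y)
  ... | inj₂ x∈z = x≢z (x∈⁅y⁆⇒x≡y z x∈z)

-- Among 2k + 1 points coloured by g, some k + 1 distinct points share a colour: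
-- either the true-class or its complement has at least k + 1 elements.
monochromatic : ∀ k (g : Fin (k + suc k) → Bool) →
  ∃ λ b → Σ (Fin (suc k) → Fin (k + suc k)) λ f →
    Injective _≡_ _≡_ f × (∀ i → g (f i) ≡ b)
monochromatic k g with suc k ≤? ∣ tabulate g ∣
... | yes k<∣T∣ with choose (suc k) (tabulate g) k<∣T∣
...   | f , f-inj , f∈T = true , f , f-inj , ∈-tabulate⁻ g ∘ f∈T
monochromatic k g | no k≮∣T∣ with choose (suc k) (∁ (tabulate g)) k<∣F∣
  where
  open ≤-Reasoning
  k<∣F∣ : suc k ≤ ∣ ∁ (tabulate g) ∣
  k<∣F∣ = begin
    suc k                        ≡⟨ m+n∸m≡n k (suc k) ⟨
    k + suc k ∸ k                ≤⟨ ∸-monoʳ-≤ (k + suc k) (s≤s⁻¹ (≰⇒> k≮∣T∣)) ⟩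
    k + suc k ∸ ∣ tabulate g ∣   ≡⟨ ∣∁p∣≡n∸∣p∣ (tabulate g) ⟨
    ∣ ∁ (tabulate g) ∣           ∎
... | f , f-inj , f∈F = false , f , f-inj , colour-false
  where
  colour-false : ∀ i → g (f i) ≡ false
  colour-false i = ¬-not (x∈∁p⇒x∉p (f∈F i) ∘ ∈-tabulate⁺ g)

twoOfThree : (p q r : Bool) → p ≡ q ⊎ p ≡ r ⊎ q ≡ r
twoOfThree false false _     = inj₁ refl
twoOfThree true  true  _     = inj₁ refl
twoOfThree false true  false = inj₂ (inj₁ refl)
twoOfThree true  false true  = inj₂ (inj₁ refl)
twoOfThree false true  true  = inj₂ (inj₂ refl)
twoOfThree true  false false = inj₂ (inj₂ refl)

module _ {n : ℕ} (G : Graph n) where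
  open Graph G using (adj) renaming (sym to adj-sym; irrefl to adj-irrefl)

  adj⇒≢ : ∀ {u z} → adj u z ≡ true → u ≢ z
  adj⇒≢ {u} uz refl with trans (sym uz) (adj-irrefl u)
  ... | ()

  dist-unique : ∀ {u z k k′} → Dist G u z k → Dist G u z k′ → k ≡ k′
  dist-unique (w , shortest) (w′ , shortest′) = ≤-antisym (shortest _ w′) (shortest′ _ w)

  walk₀ : ∀ {u z} → Walk G u z 0 → u ≡ z
  walk₀ nil = refl

  walk₁ : ∀ {u z} → Walk G u z 1 → adj u z ≡ true
  walk₁ (cons uz nil) = uz

  dist-adjacent : ∀ {u z} → adj u z ≡ true → Dist G u z 1
  dist-adjacent {u} {z} uz = cons uz nil , shortest
    where
    shortest : ∀ k → Walk G u z k → 1 ≤ k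
    shortest zero    w = contradiction (walk₀ w) (adj⇒≢ uz)
    shortest (suc k) _ = s≤s z≤n

  dist-commonNeighbour : ∀ {u m z} → u ≢ z → adj u z ≡ false →
    adj u m ≡ true → adj m z ≡ true → Dist G u z 2
  dist-commonNeighbour {u} {m} {z} u≢z u≁z um mz = cons um (cons mz nil) , shortest
    where
    shortest : ∀ k → Walk G u z k → 2 ≤ k
    shortest zero          w = contradiction (walk₀ w) u≢z
    shortest (suc zero)    w with trans (sym u≁z) (walk₁ w)
    ... | ()
    shortest (suc (suc k)) _ = s≤s (s≤s z≤n)

  distBy : Bool → ℕ
  distBy true  = 1
  distBy false = 2

  dist-viaNeighbour : ∀ {u m z} → u ≢ z → adj u m ≡ true → adj m z ≡ true →
    Dist G u z (distBy (adj u z))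
  dist-viaNeighbour {u} {z = z} u≢z um mz with adj u z in uz
  ... | true  = dist-adjacent uz
  ... | false = dist-commonNeighbour u≢z uz um mz

  Equidistant : Fin n → Fin n → Fin n → Set
  Equidistant u w z = ∃ λ k → Dist G u z k × Dist G w z k

  equidistant⇒¬resolving : ∀ {u w W} → u ≢ w →
    (∀ z → z ∈ W → Equidistant u w z) → ¬ Resolving G W
  equidistant⇒¬resolving {u} {w} {W} u≢w equidistant resolving =
    u≢w (resolving u w same-distance)
    where
    same-distance : ∀ z → z ∈ W → ∀ k → Dist G u z k → Dist G w z k
    same-distance z z∈W k du′ with equidistant z z∈W
    ... | _ , du , dw = subst (Dist G w z) (dist-unique du du′) dw

  equidistant-viaNeighbour : ∀ {u w m z} → u ≢ z → w ≢ z →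
    adj u m ≡ true → adj w m ≡ true → adj m z ≡ true →
    adj u z ≡ adj w z → Equidistant u w z
  equidistant-viaNeighbour {u} {w} {m} {z} u≢z w≢z um wm mz alike =
    distBy (adj u z) ,
    dist-viaNeighbour u≢z um mz ,
    subst (λ b → Dist G w z (distBy b)) (sym alike) (dist-viaNeighbour w≢z wm mz)

  configuration : ∀ {v a b c d} →
    adj v a ≡ true → adj v b ≡ true → adj v c ≡ true → adj v d ≡ true →
    c ≢ d → c ≢ a → c ≢ b → d ≢ a → d ≢ b →
    adj a c ≡ adj a d → adj b c ≡ adj b d → ¬ Resolving G (triple v a b)
  configuration {v} {a} {b} {c} {d} va vb vc vd c≢d c≢a c≢b d≢a d≢b a-alike b-alike =
    equidistant⇒¬resolving c≢d equidistant
    where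
    toward : ∀ {x} → adj v x ≡ true → adj x v ≡ true
    toward {x} vx = trans (adj-sym x v) vx

    seen-alike : ∀ {x} → adj x c ≡ adj x d → adj c x ≡ adj d x
    seen-alike {x} alike = trans (adj-sym c x) (trans alike (adj-sym x d))

    equidistant : ∀ z → z ∈ triple v a b → Equidistant c d z
    equidistant z z∈ with ∈-triple⁻ z∈
    ... | inj₁ refl        = 1 , dist-adjacent (toward vc) , dist-adjacent (toward vd)
    ... | inj₂ (inj₁ refl) =
      equidistant-viaNeighbour c≢a d≢a (toward vc) (toward vd) va (seen-alike a-alike)
    ... | inj₂ (inj₂ refl) =
      equidistant-viaNeighbour c≢b d≢b (toward vc) (toward vd) vb (seen-alike b-alike)

  resolving-triple : AllResolving G 3 → ∀ {v a b} →
    adj v a ≡ true → adj v b ≡ true → a ≢ b → Resolving G (triple v a b)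
  resolving-triple all-resolving va vb a≢b =
    all-resolving _ (∣triple∣≡3 (adj⇒≢ va) (adj⇒≢ vb) a≢b)

  -- Three distinct neighbours c₀ c₁ c₂ of v, seen alike by a further
  -- neighbour a, are impossible: some cᵢ sees the other two alike, and they
  -- form the configuration above with a and b = cᵢ.
  alikeTriple : AllResolving G 3 → ∀ {v a β} (c : Fin 3 → Fin n) →
    Injective _≡_ _≡_ c → (∀ i → a ≢ c i) →
    adj v a ≡ true → (∀ i → adj v (c i) ≡ true) → (∀ i → adj a (c i) ≡ β) → ⊥
  alikeTriple all-resolving c c-inj a≢c va vc a-colour =
    apex (twoOfThree (adj (c 0F) (c 1F)) (adj (c 0F) (c 2F)) (adj (c 1F) (c 2F)))
    where
    c-distinct : ∀ {i j} → i ≢ j → c i ≢ c j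
    c-distinct i≢j = i≢j ∘ c-inj

    unresolved : ∀ i j k → i ≢ j → i ≢ k → j ≢ k →
      adj (c i) (c j) ≡ adj (c i) (c k) → ⊥
    unresolved i j k i≢j i≢k j≢k b-alike =
      configuration va (vc i) (vc j) (vc k)
        (c-distinct j≢k) (a≢c j ∘ sym) (c-distinct (i≢j ∘ sym))
        (a≢c k ∘ sym) (c-distinct (i≢k ∘ sym))
        (trans (a-colour j) (sym (a-colour k))) b-alike
        (resolving-triple all-resolving va (vc i) (a≢c i))

    apex : adj (c 0F) (c 1F) ≡ adj (c 0F) (c 2F) ⊎ adj (c 0F) (c 1F) ≡ adj (c 1F) (c 2F)
           ⊎ adj (c 0F) (c 2F) ≡ adj (c 1F) (c 2F) → ⊥
    apex (inj₁ e)        = unresolved 0F 1F 2F (λ ()) (λ ()) (λ ()) e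
    apex (inj₂ (inj₁ e)) = unresolved 1F 0F 2F (λ ()) (λ ()) (λ ())
                             (trans (adj-sym (c 1F) (c 0F)) e)
    apex (inj₂ (inj₂ e)) = unresolved 2F 0F 1F (λ ()) (λ ()) (λ ())
                             (trans (adj-sym (c 2F) (c 0F)) (trans e (adj-sym (c 1F) (c 2F))))

  -- If every 3-set is resolving, no vertex has six distinct neighbours
  -- a, x₁, …, x₅: three of the xᵢ are seen alike by a.
  degree<6 : AllResolving G 3 → ∀ v → ¬ (6 ≤ degree G v)
  degree<6 all-resolving v 6≤deg with choose 6 (neighbours G v) 6≤deg
  ... | x , x-inj , x∈N with monochromatic 2 (λ i → adj (x 0F) (x (suc i)))
  ...   | β , h , h-inj , h-colour =
    alikeTriple all-resolving (x ∘ suc ∘ h) (h-inj ∘ suc-injective ∘ x-inj)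
      a≢c (adjacent 0F) (adjacent ∘ suc ∘ h) h-colour
    where
    adjacent : ∀ i → adj v (x i) ≡ true
    adjacent i = ∈-tabulate⁻ (adj v) (x∈N i)

    a≢c : ∀ i → x 0F ≢ x (suc (h i))
    a≢c i eq with x-inj eq
    ... | ()

mainTheorem11 : (n : ℕ) (G : Graph n) → Connected G → ResNumber G 3 → MaxDegree≤ G 5
mainTheorem11 n G _ (all-resolving , _) v with degree G v ≤? 5
... | yes deg≤5 = deg≤5
... | no  deg≰5 = ⊥-elim (degree<6 G all-resolving v (≰⇒> deg≰5))
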